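{- Let $G$ be a graph, let $D$ be a minimum dominating set of $G$ and $\gamma=|D|$. Let $\nabla_1$ be an integer with $\nabla_1\ge\nabla_1(G)$ and let $\nabla$ be an integer with $\nabla_1^B(G)<\nabla\le\nabla_1+1$. Let $$\hat D=\{v\in V(G) : \text{for all } A\subseteq D\setminus\{v\} \text{ with } N(v)\subseteq N[A] \text{ we have } |A|>2\nabla-1\}.$$ Then $|\hat D\setminus D|<\rho(G)\cdot\gamma$.
   Context: Graphs are finite, undirected and simple. $N(v)$ is the open neighborhood of $v$, $N[v]=N(v)\cup\{v\}$, and $N[A]=\bigcup_{v\in A}N[v]$. A dominating set is a set $D$ with $N[D]=V(G)$. A graph $H$ is a $1$-shallow minor of $G$ if there are pairwise vertex-disjoint connected subgraphs $G_v\subseteq G$ ($v\in V(H)$), each of radius at most $1$, such that whenever $\{u,v\}\in E(H)$ there is an edge of $G$ between $V(G_u)$ and $V(G_v)$. $\nabla_1(G)$ is the maximum of $|E(H)|/|V(H)|$ over all $1$-shallow minors $H$ of $G$, and $\nabla_1^B(G)$ is the maximum of $|E(H)|/|V(H)|$ over all bipartite $1$-shallow minors $H$ of $G$. The Hall ratio is $\rho(G)=\max\{|V(H)|/\alpha(H) : H\subseteq G\}$, where $\alpha(H)$ is the size of a largest independent set of $H$ and the maximum is over nonempty subgraphs. -}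

module Defs where

open import Data.Bool using (Bool; true; false; _∧_)
open import Data.Nat using (ℕ; zero; suc; _+_; _*_; _∸_; _≤_; _<_)
open import Data.Nat.Base using (_<ᵇ_)
open import Data.Fin using (Fin; toℕ)
open import Data.Fin.Subset using (Subset; _∈_; _∉_; _⊆_; ∣_∣; _─_; ⁅_⁆)
open import Data.Vec using (tabulate)
open import Data.List using (List; map; allFin)
open import Data.Nat.ListAction using (sum)
open import Data.Product using (Σ; Σ-syntax; _×_; ∃; ∃-syntax)
open import Data.Sum using (_⊎_)
open import Relation.Binary.PropositionalEquality using (_≡_; _≢_)
open import Function.Bundles using (_⇔_)

record Graph (n : ℕ) : Set where
  field
    adj   : Fin n → Fin n → Bool
    sym   : ∀ u v → adj u v ≡ adj v u
    irref : ∀ v → adj v v ≡ false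
open Graph public

IsSimple : (m : ℕ) → (Fin m → Fin m → Bool) → Set
IsSimple m E = (∀ u v → E u v ≡ E v u) × (∀ v → E v v ≡ false)

numEdges : (m : ℕ) → (Fin m → Fin m → Bool) → ℕ
numEdges m E = sum (map (λ i → ∣ tabulate (λ j → E i j ∧ (toℕ i <ᵇ toℕ j)) ∣) (allFin m))

InClosedNbhd : ∀ {n} → Graph n → Subset n → Fin n → Set
InClosedNbhd G A u = (u ∈ A) ⊎ (Σ[ a ∈ Fin _ ] (a ∈ A × adj G a u ≡ true))

OpenNbhd⊆ClosedNbhd : ∀ {n} → Graph n → Fin n → Subset n → Set
OpenNbhd⊆ClosedNbhd G v A = ∀ u → adj G v u ≡ true → InClosedNbhd G A u

IsDominating : ∀ {n} → Graph n → Subset n → Set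
IsDominating G D = ∀ v → InClosedNbhd G D v

IsMinimumDominating : ∀ {n} → Graph n → Subset n → Set
IsMinimumDominating G D = IsDominating G D × (∀ D' → IsDominating G D' → ∣ D ∣ ≤ ∣ D' ∣)

-- H (on Fin m, adjacency EH) is a 1-shallow minor of G: branch sets B x, each the
-- vertex set of a connected subgraph of radius ≤ 1 (a centre c x ∈ B x such that
-- every other vertex of B x is adjacent to c x), pairwise disjoint, and every edge
-- of H is realised by an edge of G between the corresponding branch sets.
record ShallowMinor1 {n : ℕ} (G : Graph n) (m : ℕ) (EH : Fin m → Fin m → Bool) : Set where
  field
    branch   : Fin m → Subset n
    centre   : Fin m → Fin n
    centre∈  : ∀ x → centre x ∈ branch x
    radius≤1 : ∀ x w → w ∈ branch x → w ≡ centre x ⊎ adj G (centre x) w ≡ true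
    disjoint : ∀ x y w → x ≢ y → w ∈ branch x → w ∉ branch y
    edges    : ∀ x y → EH x y ≡ true →
               Σ[ u ∈ Fin n ] Σ[ w ∈ Fin n ] (u ∈ branch x × w ∈ branch y × adj G u w ≡ true)

IsBipartite : (m : ℕ) → (Fin m → Fin m → Bool) → Set
IsBipartite m E = Σ[ c ∈ (Fin m → Bool) ] (∀ x y → E x y ≡ true → c x ≢ c y)

-- ∇₁(G) ≤ d  (d integer):  |E(H)| / |V(H)| ≤ d for every 1-shallow minor H.
Nabla1≤ : ∀ {n} → Graph n → ℕ → Set
Nabla1≤ G d = ∀ m (EH : Fin m → Fin m → Bool) → IsSimple m EH → ShallowMinor1 G m EH →
              numEdges m EH ≤ d * m

-- ∇₁ᴮ(G) < d:  |E(H)| / |V(H)| < d for every (nonempty) bipartite 1-shallow minor H.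
Nabla1B< : ∀ {n} → Graph n → ℕ → Set
Nabla1B< G d = ∀ m (EH : Fin m → Fin m → Bool) → 1 ≤ m → IsSimple m EH → IsBipartite m EH →
               ShallowMinor1 G m EH → numEdges m EH < d * m

record Subgraph {n : ℕ} (G : Graph n) : Set where
  field
    verts  : Subset n
    edge   : Fin n → Fin n → Bool
    esym   : ∀ u v → edge u v ≡ edge v u
    e⊆adj  : ∀ u v → edge u v ≡ true → adj G u v ≡ true
    e⊆vert : ∀ u v → edge u v ≡ true → u ∈ verts
open Subgraph public

IsIndependentIn : ∀ {n} {G : Graph n} → Subgraph G → Subset n → Set
IsIndependentIn H I = I ⊆ verts H × (∀ u v → u ∈ I → v ∈ I → edge H u v ≡ false)

IsAlpha : ∀ {n} {G : Graph n} → Subgraph G → ℕ → Set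
IsAlpha H a = (Σ[ I ∈ Subset _ ] (IsIndependentIn H I × ∣ I ∣ ≡ a))
            × (∀ I → IsIndependentIn H I → ∣ I ∣ ≤ a)

-- x < ρ(G) · γ, where ρ(G) = max over nonempty subgraphs H of |V(H)| / α(H):
-- some nonempty subgraph H has x · α(H) < |V(H)| · γ.
LtHallRatioTimes : ∀ {n} → Graph n → ℕ → ℕ → Set
LtHallRatioTimes G x γ = Σ[ H ∈ Subgraph G ] Σ[ a ∈ ℕ ]
  (1 ≤ ∣ verts H ∣ × IsAlpha H a × x * a < ∣ verts H ∣ * γ)

InDhat : ∀ {n} → Graph n → Subset n → ℕ → Fin n → Set
InDhat G D ∇ v = ∀ A → A ⊆ (D ─ ⁅ v ⁆) → OpenNbhd⊆ClosedNbhd G v A → 2 * ∇ ∸ 1 < ∣ A ∣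

-- Take a largest independent set I of G[D̂ ∖ D]. Contracting every vertex outside I onto a
-- dominator in D (vertices of D onto themselves) and keeping the vertices of I as singletons
-- gives a bipartite 1-shallow minor H on |I| + γ vertices, in which v ∈ I is joined to d ∈ D
-- when v has a neighbour in the branch set of d. These d dominate N(v), so by the definition
-- of D̂ every v ∈ I has degree at least 2∇ in H. Hence 2∇|I| ≤ |E(H)| < ∇(|I| + γ), so
-- α(G[D̂ ∖ D]) = |I| < γ and G[D̂ ∖ D] witnesses |D̂ ∖ D| < ρ(G)·γ (if D̂ ∖ D is empty, any
-- single vertex does).
module Submission where

open import Defs
open import Data.Bool using (Bool; true; false; not; _∧_)
open import Data.Bool.Properties using (∧-conicalˡ; ∧-conicalʳ; ∧-identityʳ; T-≡) renaming (_≟_ to _≟ᵇ_)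
open import Data.Empty using (⊥-elim)
open import Data.Fin using (Fin; zero; suc; toℕ; splitAt; join; _↑ˡ_; _↑ʳ_)
open import Data.Fin.Properties
  using (any?; all?; splitAt-↑ˡ; splitAt-↑ʳ; join-splitAt; toℕ-↑ˡ; toℕ-↑ʳ; toℕ<n; suc-injective)
  renaming (_≟_ to _≟ᶠ_)
open import Data.Fin.Subset using (Subset; _∈_; _∉_; _⊆_; ∣_∣; ⁅_⁆; _─_) renaming (⊥ to ∅)
open import Data.Fin.Subset.Properties
  using (_∈?_; _⊆?_; ∉⊥; ∣⁅x⁆∣≡1; p⊆q⇒∣p∣≤∣q∣; x∈⁅y⁆⇒x≡y; x≢y⇒x∉⁅y⁆; x∈p∧x∉q⇒x∈p─q)
open import Data.List using (map) renaming (tabulate to tabulateˡ)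
open import Data.Nat using (ℕ; zero; suc; _+_; _*_; _≤_; _<_; z≤n; s≤s; _<ᵇ_)
open import Data.Nat.ListAction using (sum)
open import Data.Nat.Properties hiding (suc-injective)
open import Data.Product using (Σ; Σ-syntax; _×_; _,_; proj₁; proj₂)
open import Data.Sum using (_⊎_; inj₁; inj₂)
open import Data.Vec using (_∷_; []; here; there; lookup; tabulate)
open import Data.Vec.Properties using ([]=⇒lookup; lookup⇒[]=; lookup∘tabulate)
open import Function using (_∘_; id)
open import Function.Bundles using (_⇔_; Equivalence)
open import Relation.Binary.PropositionalEquality as ≡
  using (_≡_; _≢_; refl; trans; cong; cong₂; subst)
open import Relation.Nullary using (Dec; yes; no; ¬_; does)
open import Relation.Nullary.Decidable using (dec-true; _×-dec_; _→-dec_)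
open import Relation.Unary using (Decidable)

dec-true⁻¹ : ∀ {a} {A : Set a} (a? : Dec A) → does a? ≡ true → A
dec-true⁻¹ (yes a) _  = a
dec-true⁻¹ (no _)  ()

∈-tabulate⁺ : ∀ {n} (f : Fin n → Bool) {i} → f i ≡ true → i ∈ tabulate f
∈-tabulate⁺ f {i} fi = lookup⇒[]= i _ (trans (lookup∘tabulate f i) fi)

∈-tabulate⁻ : ∀ {n} (f : Fin n → Bool) {i} → i ∈ tabulate f → f i ≡ true
∈-tabulate⁻ f {i} i∈ = trans (≡.sym (lookup∘tabulate f i)) ([]=⇒lookup i∈)

∉⇒lookup≡false : ∀ {n} {p : Subset n} {i} → i ∉ p → lookup p i ≡ false
∉⇒lookup≡false {p = p} {i} i∉p with lookup p i in eq
... | true  = ⊥-elim (i∉p (lookup⇒[]= i p eq))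
... | false = refl

∈⇒∣p∣≥1 : ∀ {n} {p : Subset n} {i} → i ∈ p → 1 ≤ ∣ p ∣
∈⇒∣p∣≥1 {i = i} i∈p = subst (_≤ _) (∣⁅x⁆∣≡1 i)
  (p⊆q⇒∣p∣≤∣q∣ (λ j∈⁅i⁆ → subst (_∈ _) (≡.sym (x∈⁅y⁆⇒x≡y _ j∈⁅i⁆)) i∈p))

∣tabulate∣-mono : ∀ {n} {f g : Fin n → Bool} → (∀ i → f i ≡ true → g i ≡ true) →
                  ∣ tabulate f ∣ ≤ ∣ tabulate g ∣
∣tabulate∣-mono {f = f} {g} f⇒g =
  p⊆q⇒∣p∣≤∣q∣ (λ i∈ → ∈-tabulate⁺ g (f⇒g _ (∈-tabulate⁻ f i∈)))

∣tabulate∘↑ʳ∣≤∣tabulate∣ : ∀ k {l} (f : Fin (k + l) → Bool) →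
                           ∣ tabulate (λ j → f (k ↑ʳ j)) ∣ ≤ ∣ tabulate f ∣
∣tabulate∘↑ʳ∣≤∣tabulate∣ zero    f = ≤-refl
∣tabulate∘↑ʳ∣≤∣tabulate∣ (suc k) f with f zero
... | true  = m≤n⇒m≤1+n (∣tabulate∘↑ʳ∣≤∣tabulate∣ k (f ∘ suc))
... | false = ∣tabulate∘↑ʳ∣≤∣tabulate∣ k (f ∘ suc)

enum : ∀ {n} (p : Subset n) → Fin ∣ p ∣ → Fin n
enum (true  ∷ p) zero    = zero
enum (true  ∷ p) (suc j) = suc (enum p j)
enum (false ∷ p) j       = suc (enum p j)

enum-∈ : ∀ {n} (p : Subset n) j → enum p j ∈ p
enum-∈ (true  ∷ p) zero    = here
enum-∈ (true  ∷ p) (suc j) = there (enum-∈ p j)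
enum-∈ (false ∷ p) j       = there (enum-∈ p j)

enum-injective : ∀ {n} (p : Subset n) {i j} → enum p i ≡ enum p j → i ≡ j
enum-injective (true  ∷ p) {zero}  {zero}  _  = refl
enum-injective (true  ∷ p) {suc i} {suc j} eq = cong suc (enum-injective p (suc-injective eq))
enum-injective (false ∷ p)                 eq = enum-injective p (suc-injective eq)

∣tabulate-∧∣≡∣tabulate∘enum∣ : ∀ {n} (p : Subset n) (f : Fin n → Bool) →
                               ∣ tabulate (λ i → lookup p i ∧ f i) ∣ ≡ ∣ tabulate (f ∘ enum p) ∣
∣tabulate-∧∣≡∣tabulate∘enum∣ []          f = refl
∣tabulate-∧∣≡∣tabulate∘enum∣ (true  ∷ p) f with f zero
... | true  = cong suc (∣tabulate-∧∣≡∣tabulate∘enum∣ p (f ∘ suc))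
... | false = ∣tabulate-∧∣≡∣tabulate∘enum∣ p (f ∘ suc)
∣tabulate-∧∣≡∣tabulate∘enum∣ (false ∷ p) f = ∣tabulate-∧∣≡∣tabulate∘enum∣ p (f ∘ suc)

∑ : ∀ {m} → (Fin m → ℕ) → ℕ
∑ {zero}  f = 0
∑ {suc m} f = f zero + ∑ (f ∘ suc)

sum-map-tabulate : ∀ {A : Set} {m} (g : Fin m → A) (f : A → ℕ) →
                   sum (map f (tabulateˡ g)) ≡ ∑ (f ∘ g)
sum-map-tabulate {m = zero}  g f = refl
sum-map-tabulate {m = suc m} g f = cong (f (g zero) +_) (sum-map-tabulate (g ∘ suc) f)

∑∘↑ˡ≤∑ : ∀ k {l} (f : Fin (k + l) → ℕ) → ∑ (λ i → f (i ↑ˡ l)) ≤ ∑ f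
∑∘↑ˡ≤∑ zero    f = z≤n
∑∘↑ˡ≤∑ (suc k) f = +-monoʳ-≤ (f zero) (∑∘↑ˡ≤∑ k (f ∘ suc))

*≤∑ : ∀ {k} c (f : Fin k → ℕ) → (∀ i → c ≤ f i) → k * c ≤ ∑ f
*≤∑ {zero}  c f c≤f = z≤n
*≤∑ {suc k} c f c≤f = +-mono-≤ (c≤f zero) (*≤∑ c (f ∘ suc) (c≤f ∘ suc))

forwardDegree : ∀ {m} → (Fin m → Fin m → Bool) → Fin m → ℕ
forwardDegree E x = ∣ tabulate (λ y → E x y ∧ (toℕ x <ᵇ toℕ y)) ∣

numEdges≡∑forwardDegree : ∀ m (E : Fin m → Fin m → Bool) → numEdges m E ≡ ∑ (forwardDegree E)
numEdges≡∑forwardDegree m E = sum-map-tabulate id (forwardDegree E)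

data Largest {n} (P : Subset n → Set) : Set where
  unsatisfiable : (∀ p → ¬ P p) → Largest P
  largest       : (p : Subset n) → P p → (∀ q → P q → ∣ q ∣ ≤ ∣ p ∣) → Largest P

largest? : ∀ {n} {P : Subset n → Set} → Decidable P → Largest P
largest? {zero} P? with P? []
... | yes P[] = largest [] P[] λ { [] _ → z≤n }
... | no ¬P[] = unsatisfiable λ { [] → ¬P[] }
largest? {suc n} P? with largest? (P? ∘ (false ∷_)) | largest? (P? ∘ (true ∷_))
... | unsatisfiable ¬P₀ | unsatisfiable ¬P₁ =
  unsatisfiable λ { (false ∷ q) → ¬P₀ q ; (true ∷ q) → ¬P₁ q }
... | largest p₀ P₀ max₀ | unsatisfiable ¬P₁ =
  largest (false ∷ p₀) P₀ λ { (false ∷ q) Pq → max₀ q Pq ; (true ∷ q) Pq → ⊥-elim (¬P₁ q Pq) }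
... | unsatisfiable ¬P₀ | largest p₁ P₁ max₁ =
  largest (true ∷ p₁) P₁ λ { (false ∷ q) Pq → ⊥-elim (¬P₀ q Pq) ; (true ∷ q) Pq → s≤s (max₁ q Pq) }
... | largest p₀ P₀ max₀ | largest p₁ P₁ max₁ with ∣ p₀ ∣ ≤? suc ∣ p₁ ∣
...   | yes p₀≤p₁ =
  largest (true ∷ p₁) P₁ λ { (false ∷ q) Pq → ≤-trans (max₀ q Pq) p₀≤p₁ ; (true ∷ q) Pq → s≤s (max₁ q Pq) }
...   | no p₀≰p₁ =
  largest (false ∷ p₀) P₀ λ { (false ∷ q) Pq → max₀ q Pq
                            ; (true ∷ q) Pq → ≤-trans (s≤s (max₁ q Pq)) (<⇒≤ (≰⇒> p₀≰p₁)) }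

IsIndependent : ∀ {n} → Graph n → Subset n → Set
IsIndependent G I = ∀ u v → u ∈ I → v ∈ I → adj G u v ≡ false

module _ {n} {G : Graph n} where

  isIndependentIn? : (H : Subgraph G) → Decidable (IsIndependentIn H)
  isIndependentIn? H I = (I ⊆? verts H) ×-dec
    all? (λ u → all? (λ v → (u ∈? I) →-dec ((v ∈? I) →-dec (edge H u v ≟ᵇ false))))

  alpha : (H : Subgraph G) → Σ ℕ (IsAlpha H)
  alpha H with largest? (isIndependentIn? H)
  ... | unsatisfiable ¬indep = ⊥-elim (¬indep ∅ ((λ i∈∅ → ⊥-elim (∉⊥ i∈∅)) , λ _ _ u∈∅ _ → ⊥-elim (∉⊥ u∈∅)))
  ... | largest I indep max = ∣ I ∣ , (I , indep , refl) , max

induced : ∀ {n} (G : Graph n) → Subset n → Subgraph G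
induced G X = record
  { verts  = X
  ; edge   = λ u v → adj G u v ∧ lookup X u ∧ lookup X v
  ; esym   = symmetric
  ; e⊆adj  = λ u v → ∧-conicalˡ _ _
  ; e⊆vert = λ u v e → lookup⇒[]= u X (∧-conicalˡ _ (lookup X v) (∧-conicalʳ (adj G u v) _ e))
  }
  where
  symmetric : ∀ u v → adj G u v ∧ lookup X u ∧ lookup X v ≡ adj G v u ∧ lookup X v ∧ lookup X u
  symmetric u v rewrite Graph.sym G u v with lookup X u | lookup X v
  ... | true  | true  = refl
  ... | true  | false = refl
  ... | false | true  = refl
  ... | false | false = refl

independentIn-induced⇒independent : ∀ {n} {G : Graph n} {X I} →
                                    IsIndependentIn (induced G X) I → IsIndependent G I
independentIn-induced⇒independent {G = G} {X} (I⊆X , indep) u v u∈I v∈I = begin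
  adj G u v                               ≡⟨ ∧-identityʳ _ ⟨
  adj G u v ∧ true ∧ true                 ≡⟨ cong₂ (λ b c → adj G u v ∧ b ∧ c) Xu Xv ⟨
  adj G u v ∧ lookup X u ∧ lookup X v     ≡⟨ indep u v u∈I v∈I ⟩
  false                                   ∎
  where
  open ≡.≡-Reasoning
  Xu : lookup X u ≡ true
  Xu = []=⇒lookup (I⊆X u∈I)
  Xv : lookup X v ≡ true
  Xv = []=⇒lookup (I⊆X v∈I)

ltHallRatioTimes-induced : ∀ {n} (G : Graph (suc n)) (X : Subset (suc n)) {γ} → 1 ≤ γ →
  (∀ I → I ⊆ X → IsIndependent G I → ∣ I ∣ < γ) → LtHallRatioTimes G ∣ X ∣ γ
ltHallRatioTimes-induced {n} G X {γ} γ≥1 small with ∣ X ∣ in ∣X∣≡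
... | zero = singleton (alpha (induced G ⁅ zero ⁆))
  where
  ∣⁅0⁆∣≡1 : ∣ ⁅ zero {n} ⁆ ∣ ≡ 1
  ∣⁅0⁆∣≡1 = ∣⁅x⁆∣≡1 {suc n} zero
  singleton : Σ ℕ (IsAlpha (induced G ⁅ zero ⁆)) → LtHallRatioTimes G 0 γ
  singleton (a , α) =
    induced G ⁅ zero ⁆ , a , ≤-reflexive (≡.sym ∣⁅0⁆∣≡1) , α ,
    subst (λ s → 0 < s * γ) (≡.sym ∣⁅0⁆∣≡1) (subst (0 <_) (≡.sym (*-identityˡ γ)) γ≥1)
... | suc c with alpha (induced G X)
...   | a , α@((I , I-indep , ∣I∣≡a) , _) =
  induced G X , a , subst (1 ≤_) (≡.sym ∣X∣≡) (s≤s z≤n) , α ,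
  subst (λ s → suc c * a < s * γ) (≡.sym ∣X∣≡) (*-monoʳ-< (suc c) (subst (_< γ) ∣I∣≡a
    (small I (proj₁ I-indep) (independentIn-induced⇒independent {G = G} {X} I-indep))))

dominating⇒∣D∣≥1 : ∀ {n} {G : Graph (suc n)} {D} → IsDominating G D → 1 ≤ ∣ D ∣
dominating⇒∣D∣≥1 D-dom with D-dom zero
... | inj₁ zero∈D        = ∈⇒∣p∣≥1 zero∈D
... | inj₂ (d , d∈D , _) = ∈⇒∣p∣≥1 d∈D

dominator : ∀ {n} {G : Graph n} {D} → IsDominating G D → ∀ u →
            Σ[ d ∈ Fin n ] (d ∈ D × (u ≡ d ⊎ adj G d u ≡ true) × (u ∈ D → d ≡ u))
dominator {D = D} D-dom u with u ∈? D
... | yes u∈D = u , u∈D , inj₁ refl , λ _ → refl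
... | no  u∉D with D-dom u
...   | inj₁ u∈D            = ⊥-elim (u∉D u∈D)
...   | inj₂ (d , d∈D , du) = d , d∈D , inj₂ du , λ u∈D → ⊥-elim (u∉D u∈D)

splitAt-injective : ∀ k {l} {x y : Fin (k + l)} → splitAt k x ≡ splitAt k y → x ≡ y
splitAt-injective k {l} {x} {y} eq =
  trans (≡.sym (join-splitAt k l x)) (trans (cong (join k l) eq) (join-splitAt k l y))

module BipartiteMinor {n} (G : Graph n) {D : Subset n} (D-dom : IsDominating G D)
                      {I : Subset n} (I-indep : IsIndependent G I)
                      (I∩D≡∅ : ∀ {v} → v ∈ I → v ∉ D) where

  k γ m : ℕ
  k = ∣ I ∣
  γ = ∣ D ∣
  m = k + γ

  dom : Fin n → Fin n
  dom u = proj₁ (dominator {G = G} D-dom u)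

  dom-∈ : ∀ u → dom u ∈ D
  dom-∈ u = proj₁ (proj₂ (dominator {G = G} D-dom u))

  dom-dominates : ∀ u → u ≡ dom u ⊎ adj G (dom u) u ≡ true
  dom-dominates u = proj₁ (proj₂ (proj₂ (dominator {G = G} D-dom u)))

  dom-fixes-D : ∀ {u} → u ∈ D → dom u ≡ u
  dom-fixes-D {u} = proj₂ (proj₂ (proj₂ (dominator {G = G} D-dom u)))

  inBranch : Fin n → Fin n → Bool
  inBranch d u = not (lookup I u) ∧ does (dom u ≟ᶠ d)

  inBranch⇒∉I : ∀ {d u} → inBranch d u ≡ true → u ∉ I
  inBranch⇒∉I e u∈I with () ← subst (λ b → not b ≡ true) ([]=⇒lookup u∈I) (∧-conicalˡ _ _ e)

  inBranch⇒dom : ∀ {d u} → inBranch d u ≡ true → dom u ≡ d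
  inBranch⇒dom {d} {u} e = dec-true⁻¹ (dom u ≟ᶠ d) (∧-conicalʳ (not (lookup I u)) _ e)

  inBranch-dom : ∀ {u} → u ∉ I → inBranch (dom u) u ≡ true
  inBranch-dom {u} u∉I rewrite ∉⇒lookup≡false u∉I = dec-true (dom u ≟ᶠ dom u) refl

  reaches : Fin n → Fin n → Bool
  reaches v d = does (any? λ u → (adj G v u ≟ᵇ true) ×-dec (inBranch d u ≟ᵇ true))

  reaches⁺ : ∀ {v d} u → adj G v u ≡ true → inBranch d u ≡ true → reaches v d ≡ true
  reaches⁺ u vu du = dec-true (any? _) (u , vu , du)

  reaches⁻ : ∀ {v d} → reaches v d ≡ true → Σ[ u ∈ Fin n ] (adj G v u ≡ true × inBranch d u ≡ true)
  reaches⁻ = dec-true⁻¹ (any? _)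

  eI : Fin k → Fin n
  eI = enum I

  eD : Fin γ → Fin n
  eD = enum D

  Side : Set
  Side = Fin k ⊎ Fin γ

  branch : Side → Fin n → Bool
  branch (inj₁ i) w = does (w ≟ᶠ eI i)
  branch (inj₂ j) w = inBranch (eD j) w

  centre : Side → Fin n
  centre (inj₁ i) = eI i
  centre (inj₂ j) = eD j

  joined : Side → Side → Bool
  joined (inj₁ i) (inj₁ _) = false
  joined (inj₁ i) (inj₂ j) = reaches (eI i) (eD j)
  joined (inj₂ j) (inj₁ i) = reaches (eI i) (eD j)
  joined (inj₂ j) (inj₂ _) = false

  inI? : Side → Bool
  inI? (inj₁ _) = true
  inI? (inj₂ _) = false

  centre∈branch : ∀ s → branch s (centre s) ≡ true
  centre∈branch (inj₁ i) = dec-true (eI i ≟ᶠ eI i) refl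
  centre∈branch (inj₂ j) = subst (λ d → inBranch d (eD j) ≡ true) (dom-fixes-D (enum-∈ D j))
                                 (inBranch-dom (λ eDj∈I → I∩D≡∅ eDj∈I (enum-∈ D j)))

  branch-radius≤1 : ∀ s w → branch s w ≡ true → w ≡ centre s ⊎ adj G (centre s) w ≡ true
  branch-radius≤1 (inj₁ i) w e = inj₁ (dec-true⁻¹ (w ≟ᶠ eI i) e)
  branch-radius≤1 (inj₂ j) w e =
    subst (λ d → w ≡ d ⊎ adj G d w ≡ true) (inBranch⇒dom e) (dom-dominates w)

  branch-disjoint : ∀ s t w → branch s w ≡ true → branch t w ≡ true → s ≡ t
  branch-disjoint (inj₁ i) (inj₁ i') w e e' =
    cong inj₁ (enum-injective I (trans (≡.sym (dec-true⁻¹ (w ≟ᶠ _) e)) (dec-true⁻¹ (w ≟ᶠ _) e')))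
  branch-disjoint (inj₂ j) (inj₂ j') w e e' =
    cong inj₂ (enum-injective D (trans (≡.sym (inBranch⇒dom e)) (inBranch⇒dom e')))
  branch-disjoint (inj₁ i) (inj₂ j) w e e' =
    ⊥-elim (inBranch⇒∉I e' (subst (_∈ I) (≡.sym (dec-true⁻¹ (w ≟ᶠ eI i) e)) (enum-∈ I i)))
  branch-disjoint (inj₂ j) (inj₁ i) w e e' = ≡.sym (branch-disjoint (inj₁ i) (inj₂ j) w e' e)

  joined-realised : ∀ s t → joined s t ≡ true →
    Σ[ u ∈ Fin n ] Σ[ w ∈ Fin n ] (branch s u ≡ true × branch t w ≡ true × adj G u w ≡ true)
  joined-realised (inj₁ i) (inj₂ j) e with reaches⁻ e
  ... | u , vu , du = eI i , u , centre∈branch (inj₁ i) , du , vu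
  joined-realised (inj₂ j) (inj₁ i) e with reaches⁻ e
  ... | u , vu , du = u , eI i , du , centre∈branch (inj₁ i) , trans (Graph.sym G u (eI i)) vu

  joined-sym : ∀ s t → joined s t ≡ joined t s
  joined-sym (inj₁ i) (inj₁ _) = refl
  joined-sym (inj₁ i) (inj₂ j) = refl
  joined-sym (inj₂ j) (inj₁ i) = refl
  joined-sym (inj₂ j) (inj₂ _) = refl

  joined-irrefl : ∀ s → joined s s ≡ false
  joined-irrefl (inj₁ i) = refl
  joined-irrefl (inj₂ j) = refl

  joined-bipartite : ∀ s t → joined s t ≡ true → inI? s ≢ inI? t
  joined-bipartite (inj₁ i) (inj₂ j) _ ()
  joined-bipartite (inj₂ j) (inj₁ i) _ ()

  H : Fin m → Fin m → Bool
  H x y = joined (splitAt k x) (splitAt k y)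

  H-simple : IsSimple m H
  H-simple = (λ x y → joined-sym (splitAt k x) (splitAt k y)) , (λ x → joined-irrefl (splitAt k x))

  H-bipartite : IsBipartite m H
  H-bipartite = inI? ∘ splitAt k , λ x y → joined-bipartite (splitAt k x) (splitAt k y)

  H-minor : ShallowMinor1 G m H
  H-minor = record
    { branch   = λ x → tabulate (branch (splitAt k x))
    ; centre   = λ x → centre (splitAt k x)
    ; centre∈  = λ x → ∈-tabulate⁺ _ (centre∈branch (splitAt k x))
    ; radius≤1 = λ x w w∈ → branch-radius≤1 (splitAt k x) w (∈-tabulate⁻ _ w∈)
    ; disjoint = λ x y w x≢y w∈x w∈y → x≢y (splitAt-injective k
                   (branch-disjoint (splitAt k x) (splitAt k y) w (∈-tabulate⁻ _ w∈x) (∈-tabulate⁻ _ w∈y)))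
    ; edges    = λ x y e → realised (splitAt k x) (splitAt k y) (joined-realised (splitAt k x) (splitAt k y) e)
    }
    where
    realised : ∀ s t → Σ[ u ∈ Fin n ] Σ[ w ∈ Fin n ] (branch s u ≡ true × branch t w ≡ true × adj G u w ≡ true) →
               Σ[ u ∈ Fin n ] Σ[ w ∈ Fin n ] (u ∈ tabulate (branch s) × w ∈ tabulate (branch t) × adj G u w ≡ true)
    realised s t (u , w , su , tw , uw) = u , w , ∈-tabulate⁺ _ su , ∈-tabulate⁺ _ tw , uw

  attached : Fin n → Subset n
  attached v = tabulate (λ d → lookup D d ∧ reaches v d)

  attached⊆D─v : ∀ {v} → v ∈ I → attached v ⊆ D ─ ⁅ v ⁆
  attached⊆D─v v∈I {d} d∈ = x∈p∧x∉q⇒x∈p─q d∈D (x≢y⇒x∉⁅y⁆ λ d≡v → I∩D≡∅ v∈I (subst (_∈ D) d≡v d∈D))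
    where
    d∈D : d ∈ D
    d∈D = lookup⇒[]= d D (∧-conicalˡ _ _ (∈-tabulate⁻ _ d∈))

  neighbour∉I : ∀ {v u} → v ∈ I → adj G v u ≡ true → u ∉ I
  neighbour∉I {v} {u} v∈I vu u∈I with () ← trans (≡.sym vu) (I-indep v u v∈I u∈I)

  dom∈attached : ∀ {v u} → v ∈ I → adj G v u ≡ true → dom u ∈ attached v
  dom∈attached {v} {u} v∈I vu = ∈-tabulate⁺ _
    (cong₂ _∧_ ([]=⇒lookup (dom-∈ u)) (reaches⁺ u vu (inBranch-dom (neighbour∉I v∈I vu))))

  attached-covers : ∀ {v} → v ∈ I → OpenNbhd⊆ClosedNbhd G v (attached v)
  attached-covers {v} v∈I u vu with dom-dominates u
  ... | inj₁ u≡d = inj₁ (subst (_∈ attached v) (≡.sym u≡d) (dom∈attached v∈I vu))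
  ... | inj₂ du  = inj₂ (dom u , dom∈attached v∈I vu , du)

  -- The vertices of I come first in Fin (k + γ), so every edge of H is counted in the
  -- forward degree of its end in I.
  ∣attached∣≤forwardDegree : ∀ i → ∣ attached (eI i) ∣ ≤ forwardDegree H (i ↑ˡ γ)
  ∣attached∣≤forwardDegree i = begin
    ∣ attached (eI i) ∣                      ≡⟨ ∣tabulate-∧∣≡∣tabulate∘enum∣ D (reaches (eI i)) ⟩
    ∣ tabulate (reaches (eI i) ∘ eD) ∣       ≤⟨ ∣tabulate∣-mono forward ⟩
    ∣ tabulate (λ j → row (k ↑ʳ j)) ∣        ≤⟨ ∣tabulate∘↑ʳ∣≤∣tabulate∣ k row ⟩
    forwardDegree H (i ↑ˡ γ)                 ∎
    where
    open ≤-Reasoning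
    row : Fin m → Bool
    row y = H (i ↑ˡ γ) y ∧ (toℕ (i ↑ˡ γ) <ᵇ toℕ y)
    forward : ∀ j → reaches (eI i) (eD j) ≡ true → row (k ↑ʳ j) ≡ true
    forward j r rewrite splitAt-↑ˡ k i γ | splitAt-↑ʳ k γ j | r | toℕ-↑ˡ i γ | toℕ-↑ʳ k j =
      Equivalence.to T-≡ (<⇒<ᵇ (≤-trans (toℕ<n i) (m≤m+n k (toℕ j))))

  *≤numEdges : ∀ c → (∀ {v} → v ∈ I → c ≤ ∣ attached v ∣) → k * c ≤ numEdges m H
  *≤numEdges c c≤∣attached∣ = begin
    k * c                             ≤⟨ *≤∑ c _ (λ i → ≤-trans (c≤∣attached∣ (enum-∈ I i)) (∣attached∣≤forwardDegree i)) ⟩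
    ∑ (λ i → forwardDegree H (i ↑ˡ γ)) ≤⟨ ∑∘↑ˡ≤∑ k (forwardDegree H) ⟩
    ∑ (forwardDegree H)               ≡⟨ numEdges≡∑forwardDegree m H ⟨
    numEdges m H                      ∎
    where open ≤-Reasoning

k*2∇<∇*[k+γ]⇒k<γ : ∀ ∇ k γ → k * (2 * ∇) < ∇ * (k + γ) → k < γ
k*2∇<∇*[k+γ]⇒k<γ ∇ k γ lt = *-cancelˡ-< ∇ k γ (+-cancelˡ-< (∇ * k) (∇ * k) (∇ * γ) (begin-strict
  ∇ * k + ∇ * k  ≡⟨ *-distribˡ-+ ∇ k k ⟨
  ∇ * (k + k)    ≡⟨ cong (∇ *_) (cong (k +_) (+-identityʳ k)) ⟨
  ∇ * (2 * k)    ≡⟨ *-comm ∇ (2 * k) ⟩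
  2 * k * ∇      ≡⟨ cong (_* ∇) (*-comm 2 k) ⟩
  k * 2 * ∇      ≡⟨ *-assoc k 2 ∇ ⟩
  k * (2 * ∇)    <⟨ lt ⟩
  ∇ * (k + γ)    ≡⟨ *-distribˡ-+ ∇ k γ ⟩
  ∇ * k + ∇ * γ  ∎))
  where open ≤-Reasoning

independent⊆D̂∖D⇒∣I∣<∣D∣ : ∀ {n} {G : Graph n} {D ∇ I} → IsDominating G D → 1 ≤ ∣ D ∣ →
  Nabla1B< G ∇ → IsIndependent G I → (∀ {v} → v ∈ I → InDhat G D ∇ v × v ∉ D) → ∣ I ∣ < ∣ D ∣
independent⊆D̂∖D⇒∣I∣<∣D∣ {G = G} {D} {∇} {I} D-dom ∣D∣≥1 ∇₁ᴮ<∇ I-indep I⊆D̂∖D =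
  k*2∇<∇*[k+γ]⇒k<γ ∇ k γ (≤-<-trans (*≤numEdges (2 * ∇) degree)
    (∇₁ᴮ<∇ m H (≤-trans ∣D∣≥1 (m≤n+m γ k)) H-simple H-bipartite H-minor))
  where
  open BipartiteMinor G D-dom I-indep (proj₂ ∘ I⊆D̂∖D)
  -- 2∇ ∸ 1 < |A| yields 2∇ ≤ |A| also for ∇ = 0, where ∸ truncates.
  degree : ∀ {v} → v ∈ I → 2 * ∇ ≤ ∣ attached v ∣
  degree v∈I = ≤-trans (m≤n+m∸n (2 * ∇) 1)
    (proj₁ (I⊆D̂∖D v∈I) (attached _) (attached⊆D─v v∈I) (attached-covers v∈I))

lemma4p1 : (n : ℕ) → 1 ≤ n → (G : Graph n) → (D : Subset n) → IsMinimumDominating G D →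
    (∇₁ ∇ : ℕ) → Nabla1≤ G ∇₁ → Nabla1B< G ∇ → ∇ ≤ ∇₁ + 1 →
    (X : Subset n) → (∀ v → (v ∈ X) ⇔ (InDhat G D ∇ v × v ∉ D)) →
    LtHallRatioTimes G ∣ X ∣ ∣ D ∣
lemma4p1 (suc n) _ G D (D-dom , _) _ ∇ _ ∇₁ᴮ<∇ _ X X⇔D̂∖D =
  ltHallRatioTimes-induced G X ∣D∣≥1 λ I I⊆X I-indep →
    independent⊆D̂∖D⇒∣I∣<∣D∣ {∇ = ∇} D-dom ∣D∣≥1 ∇₁ᴮ<∇ I-indep (Equivalence.to (X⇔D̂∖D _) ∘ I⊆X)
  where
  ∣D∣≥1 : 1 ≤ ∣ D ∣
  ∣D∣≥1 = dominating⇒∣D∣≥1 {G = G} D-dom
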